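{- There exists an infinite family of square 2D strings of size $N$ with $\delta_\square = \Omega(g \sqrt{N}/(\log N\log\log N))$.
   Context: A 2D string $\mathcal{M}_{m\times n}$ is an $m\times n$ matrix over a finite alphabet, of size $N=mn$. $P_\mathcal{M}(k_1,k_2)$ is the number of distinct $k_1\times k_2$ submatrices of $\mathcal{M}$, and $\delta_\square(\mathcal{M})=\max\{P_\mathcal{M}(k,k)/k^2 : 1\le k\le \min\{m,n\}\}$. Horizontal concatenation, denoted here $A\oplus B$ (written in the paper with a rotated $\ominus$ symbol), places $B$ to the right of $A$ (equal numbers of rows); vertical concatenation $A\ominus B$ places $B$ below $A$ (equal numbers of columns). A 2D SLP is a context-free grammar uniquely generating $\mathcal{M}$ with rules $A\to a$ (size 1), $A\to B\oplus C$, $A\to B\ominus C$ (size 2); $g(\mathcal{M})$ is the size of the smallest 2D SLP generating $\mathcal{M}$. -}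

module Defs where

open import Data.Nat using (ℕ; zero; suc; _+_; _*_; _∸_; _≤_; _<_; s≤s; z≤n)
open import Data.Nat.Properties using (+-monoʳ-<; ≤-trans; m∸n+n≡m; +-comm; ≤-reflexive; +-monoˡ-≤)
open import Data.Fin using (Fin; toℕ; fromℕ<)
open import Data.Fin.Properties using (toℕ<n)
import Data.Fin.Properties as FinP
open import Data.Vec using (Vec; []; _∷_; lookup; tabulate; _++_; zipWith; head)
open import Data.Vec.Properties using (≡-dec)
open import Data.List using (List; length; deduplicate; allFin; concatMap; map)
open import Data.Maybe using (Maybe; just; nothing)
open import Data.Product using (Σ; _×_; _,_; ∃-syntax)
open import Data.Integer using (+_)
open import Data.Rational using (ℚ; _/_; _⊔_; 0ℚ)
open import Relation.Binary.PropositionalEquality using (_≡_; refl; subst; sym; trans)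
open import Relation.Nullary using (yes; no)
open import Relation.Nullary.Decidable using (map′)
open import Data.Nat using (_≟_; _≤?_)

Mat : Set → ℕ → ℕ → Set
Mat A m n = Vec (Vec A n) m

private
  idx-lemma : (m k i r : ℕ) → k ≤ m → i < suc (m ∸ k) → r < k → i + r < m
  idx-lemma m k i r k≤m (s≤s i≤) r<k =
    ≤-trans (+-monoʳ-< i r<k)
      (≤-trans (+-monoˡ-≤ k i≤) (≤-reflexive (m∸n+n≡m k≤m)))

winIdx : (m k : ℕ) → k ≤ m → Fin (suc (m ∸ k)) → Fin k → Fin m
winIdx m k k≤m i r =
  fromℕ< (idx-lemma m k (toℕ i) (toℕ r) k≤m (toℕ<n i) (toℕ<n r))

subMat : {A : Set} {m n : ℕ} (M : Mat A m n) (k₁ k₂ : ℕ)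
         (p₁ : k₁ ≤ m) (p₂ : k₂ ≤ n) →
         Fin (suc (m ∸ k₁)) → Fin (suc (n ∸ k₂)) → Mat A k₁ k₂
subMat {m = m} {n} M k₁ k₂ p₁ p₂ i j =
  tabulate λ r → tabulate λ c →
    lookup (lookup M (winIdx m k₁ p₁ i r)) (winIdx n k₂ p₂ j c)

allSubMats : {A : Set} {m n : ℕ} (M : Mat A m n) (k₁ k₂ : ℕ) →
             k₁ ≤ m → k₂ ≤ n → List (Mat A k₁ k₂)
allSubMats M k₁ k₂ p₁ p₂ =
  concatMap (λ i → map (λ j → subMat M k₁ k₂ p₁ p₂ i j) (allFin _)) (allFin _)

-- P_M(k₁,k₂): the number of distinct k₁ × k₂ submatrices of M
-- (0 if the window does not fit).  Alphabet is Fin σ.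
P : {σ m n : ℕ} → Mat (Fin σ) m n → ℕ → ℕ → ℕ
P {σ} {m} {n} M k₁ k₂ with k₁ ≤? m | k₂ ≤? n
... | yes p₁ | yes p₂ =
  length (deduplicate (≡-dec (≡-dec FinP._≟_)) (allSubMats M k₁ k₂ p₁ p₂))
... | _ | _ = 0

δ-upTo : {σ m n : ℕ} → Mat (Fin σ) m n → ℕ → ℚ
δ-upTo M zero    = 0ℚ
δ-upTo M (suc k) = δ-upTo M k ⊔ ((+ P M (suc k) (suc k)) / (suc k * suc k))

-- δ_□ for a square n × n 2D string (min{m,n} = n)
δ□ : {σ n : ℕ} → Mat (Fin σ) n n → ℚ
δ□ {n = n} M = δ-upTo M n

-- A program with r rules is a sequence of rules; a rule added to a
-- program with r earlier rules may only refer (by index Fin r) to those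
-- earlier nonterminals, which makes the grammar acyclic, hence it
-- generates a unique matrix.  The last rule added is the start symbol.

data Rule (A : Set) (r : ℕ) : Set where
  term : A → Rule A r
  hcat : Fin r → Fin r → Rule A r
  vcat : Fin r → Fin r → Rule A r

data SLP (A : Set) : ℕ → Set where
  []  : SLP A 0
  _▷_ : {r : ℕ} → SLP A r → Rule A r → SLP A (suc r)

ruleSize : {A : Set} {r : ℕ} → Rule A r → ℕ
ruleSize (term _)   = 1
ruleSize (hcat _ _) = 2
ruleSize (vcat _ _) = 2

size : {A : Set} {r : ℕ} → SLP A r → ℕ
size []      = 0
size (g ▷ x) = size g + ruleSize x

AnyMat : Set → Set
AnyMat A = Σ ℕ λ m → Σ ℕ λ n → Mat A m n

hcatM : {A : Set} → AnyMat A → AnyMat A → Maybe (AnyMat A)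
hcatM (m , n , B) (m' , n' , C) with m ≟ m'
... | yes refl = just (m , n + n' , zipWith _++_ B C)
... | no _     = nothing

vcatM : {A : Set} → AnyMat A → AnyMat A → Maybe (AnyMat A)
vcatM (m , n , B) (m' , n' , C) with n ≟ n'
... | yes refl = just (m + m' , n , B ++ C)
... | no _     = nothing

bind2 : {A : Set} → Maybe (AnyMat A) → Maybe (AnyMat A) →
        (AnyMat A → AnyMat A → Maybe (AnyMat A)) → Maybe (AnyMat A)
bind2 (just x) (just y) f = f x y
bind2 _        _        f = nothing

evalRule : {A : Set} {r : ℕ} → Vec (Maybe (AnyMat A)) r → Rule A r → Maybe (AnyMat A)
evalRule env (term a)   = just (1 , 1 , (a ∷ []) ∷ [])
evalRule env (hcat b c) = bind2 (lookup env b) (lookup env c) hcatM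
evalRule env (vcat b c) = bind2 (lookup env b) (lookup env c) vcatM

evalEnv : {A : Set} {r : ℕ} → SLP A r → Vec (Maybe (AnyMat A)) r
evalEnv []      = []
evalEnv (g ▷ x) = evalRule (evalEnv g) x ∷ evalEnv g

Generates : {A : Set} {r : ℕ} {m n : ℕ} → SLP A (suc r) → Mat A m n → Set
Generates {m = m} {n} G M = head (evalEnv G) ≡ just (m , n , M)

IsSmallestSLPSize : {A : Set} {m n : ℕ} → Mat A m n → ℕ → Set
IsSmallestSLPSize {A} M s =
  (Σ ℕ λ r → Σ (SLP A (suc r)) λ G → Generates G M × size G ≡ s)
  × ((r : ℕ) (G : SLP A (suc r)) → Generates G M → s ≤ size G)

{-# OPTIONS --safe #-}
-- Take n = 2^(s+1) and let M be the n × n matrix whose columns alternate between the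
-- column (0, 1, …, n-1)ᵀ and the constant column p, for p = 0, …, n/2 - 1.  The 2 × 2
-- window at row i and column 2p has top row (i, p), so P_M(2,2) ≥ (n-1)·n/2 and
-- δ_□ ≥ P_M(2,2)/4 = Ω(n²).  On the other hand M has a 2D SLP of size O(n log n): a
-- balanced tree of vertical concatenations builds (0, …, n-1)ᵀ once, each constant
-- column takes log n doublings, and a balanced tree of horizontal concatenations,
-- sharing the nonterminal of (0, …, n-1)ᵀ, assembles the n/2 blocks.  As √N = n,
-- log N = 2 log n and log log N ≥ 1, the two bounds give the claim with constant 1/64.
module Submission where

open import Defs

-- An anonymous module keeps the ℕ operators imported here out of the scope of the
-- theorem statement below, which uses the ℚ operators _*_ and _<_.
module _ where
  open import Data.Nat as ℕ
    using (ℕ; zero; suc; _+_; _*_; _^_; _∸_; _≤_; _<_; _≟_; _≤?_; z≤n; s≤s)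
  open import Data.Nat.Properties
    using (≤-trans; ≤-reflexive; ≤-irrelevant; ≰⇒>; m≤n⇒m<n∨m≡n; m≤m+n; m≤n+m;
           +-assoc; +-comm; +-suc; +-identityʳ; *-identityˡ; *-identityʳ; *-distribˡ-+; *-distribʳ-+; +-cancelʳ-≡;
           +-mono-≤; *-mono-≤; *-monoˡ-≤; *-monoʳ-≤; ^-distribˡ-+-*; m+n≤o⇒m≤o∸n;
           module ≤-Reasoning)
  open import Data.Nat.Logarithm using (⌊log₂_⌋; ⌊log₂[2^n]⌋≡n; ⌊log₂⌋-mono-≤)
  open import Data.Nat.Solver using (module +-*-Solver)
  open import Data.Fin using (Fin; zero; suc; toℕ; fromℕ<; _↑ˡ_; _↑ʳ_; splitAt; remQuot)
  open import Data.Fin.Properties as Finₚ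
    using (toℕ<n; toℕ-fromℕ<; toℕ-injective; toℕ-↑ˡ; toℕ-↑ʳ; ↑ˡ-injective;
           splitAt⁻¹-↑ˡ; splitAt⁻¹-↑ʳ; pigeonhole; <-irrefl; *↔×)
  open import Data.Vec using ([]; _∷_; lookup; _++_; zipWith)
  open import Data.Vec.Properties using (lookup-++ˡ; lookup-++ʳ; lookup-zipWith; ∷-injective; ≡-dec)
  open import Data.List as List using (List; length; allFin; map)
  open import Data.List.Membership.Propositional using (_∈_)
  open import Data.List.Membership.Propositional.Properties
    using (∈-deduplicate⁺; ∈-map⁺; ∈-concatMap⁺; ∈-allFin)
  import Data.List.Relation.Unary.Any as Any
  open import Data.List.Relation.Unary.Any.Properties using (lookup-index)
  open import Data.Maybe using (just)
  open import Data.Product using (_×_; _,_; proj₁; proj₂; uncurry)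
  open import Data.Sum using (inj₁; inj₂)
  open import Data.Integer as ℤ using (+_; +≤+)
  open import Data.Integer.Properties using (pos-*)
  open import Data.Rational as ℚ using (_/_; toℚᵘ)
  open import Data.Rational.Properties as ℚₚ
    using (toℚᵘ-injective; toℚᵘ-cancel-≤; toℚᵘ-fromℚᵘ; toℚᵘ-homo-*; p≤p⊔q; p≤q⊔p;
           normalize-nonNeg; *-monoʳ-≤-nonNeg)
  open import Data.Rational.Unnormalised as ℚᵘ using (mkℚᵘ; _≃_; *≡*; *≤*)
  open import Data.Rational.Unnormalised.Properties as ℚᵘₚ using (≃-sym; ≤-respˡ-≃; ≤-respʳ-≃)
  open import Function using (_∘_; id; Injective)
  open import Function.Bundles using (Injection)
  open import Function.Properties.Inverse using (↔⇒↣)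
  open import Relation.Binary.PropositionalEquality
  open import Relation.Nullary using (yes; no; contradiction)

  ≤-length-of-injective-∈ : {A : Set} {K : ℕ} (L : List A) (f : Fin K → A) →
    Injective _≡_ _≡_ f → (∀ k → f k ∈ L) → K ≤ length L
  ≤-length-of-injective-∈ {K = K} L f f-inj f∈L with K ≤? length L
  ... | yes K≤ = K≤
  ... | no K≰ with pigeonhole (≰⇒> K≰) (Any.index ∘ f∈L)
  ... | i , j , i<j , same-index = contradiction (f-inj fi≡fj) (λ i≡j → <-irrefl i≡j i<j)
    where
    fi≡fj : f i ≡ f j
    fi≡fj = trans (lookup-index (f∈L i))
              (trans (cong (List.lookup L) same-index) (sym (lookup-index (f∈L j))))

  subMat∈allSubMats : {A : Set} {m n : ℕ} (M : Mat A m n) (k₁ k₂ : ℕ) (q₁ : k₁ ≤ m) (q₂ : k₂ ≤ n)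
    (i : Fin (suc (m ∸ k₁))) (j : Fin (suc (n ∸ k₂))) →
    subMat M k₁ k₂ q₁ q₂ i j ∈ allSubMats M k₁ k₂ q₁ q₂
  subMat∈allSubMats M k₁ k₂ q₁ q₂ i j =
    ∈-concatMap⁺ (λ i′ → map (subMat M k₁ k₂ q₁ q₂ i′) (allFin _))
      (Any.map (λ { refl → ∈-map⁺ (subMat M k₁ k₂ q₁ q₂ i) (∈-allFin j) }) (∈-allFin i))

  ≤-P-of-injective-windows : {σ m n K : ℕ} (M : Mat (Fin σ) m n) (k₁ k₂ : ℕ)
    (q₁ : k₁ ≤ m) (q₂ : k₂ ≤ n)
    (window : Fin K → Fin (suc (m ∸ k₁)) × Fin (suc (n ∸ k₂))) →
    Injective _≡_ _≡_ (uncurry (subMat M k₁ k₂ q₁ q₂) ∘ window) → K ≤ P M k₁ k₂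
  ≤-P-of-injective-windows {m = m} {n} M k₁ k₂ q₁ q₂ window inj with k₁ ≤? m | k₂ ≤? n
  ... | yes p₁ | yes p₂ rewrite ≤-irrelevant p₁ q₁ | ≤-irrelevant p₂ q₂ =
    ≤-length-of-injective-∈ _ _ inj λ k →
      ∈-deduplicate⁺ (≡-dec (≡-dec Finₚ._≟_))
        (subMat∈allSubMats M k₁ k₂ q₁ q₂ (proj₁ (window k)) (proj₂ (window k)))
  ... | no k₁≰m | _      = contradiction q₁ k₁≰m
  ... | yes _   | no k₂≰n = contradiction q₂ k₂≰n

  P/k²≤δ-upTo : {σ m n : ℕ} (M : Mat (Fin σ) m n) {k K : ℕ} → suc k ≤ K →
    (+ P M (suc k) (suc k)) / (suc k * suc k) ℚ.≤ δ-upTo M K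
  P/k²≤δ-upTo M {K = suc K} (s≤s k≤K) with m≤n⇒m<n∨m≡n k≤K
  ... | inj₁ k<K  = ℚₚ.≤-trans (P/k²≤δ-upTo M k<K) (p≤p⊔q (δ-upTo M K) _)
  ... | inj₂ refl = p≤q⊔p (δ-upTo M K) _

  toℕ-winIdx : (m k : ℕ) (q : k ≤ m) (i : Fin (suc (m ∸ k))) (r : Fin k) →
    toℕ (winIdx m k q i r) ≡ toℕ i + toℕ r
  toℕ-winIdx m k q i r = toℕ-fromℕ< _

  winIdx-injectiveˡ : (m k : ℕ) (q : k ≤ m) {i i′ : Fin (suc (m ∸ k))} (r : Fin k) →
    winIdx m k q i r ≡ winIdx m k q i′ r → i ≡ i′
  winIdx-injectiveˡ m k q {i} {i′} r eq = toℕ-injective (+-cancelʳ-≡ (toℕ r) (toℕ i) (toℕ i′)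
    (trans (sym (toℕ-winIdx m k q i r)) (trans (cong toℕ eq) (toℕ-winIdx m k q i′ r))))

  toℚᵘ-/ : ∀ a d → toℚᵘ (+ a / suc d) ≃ mkℚᵘ (+ a) d
  toℚᵘ-/ a d = toℚᵘ-fromℚᵘ (mkℚᵘ (+ a) d)

  /-*-/1 : ∀ a b d → (+ a / suc d) ℚ.* (+ b / 1) ≡ + (a * b) / suc d
  /-*-/1 a b d = toℚᵘ-injective (begin
    toℚᵘ ((+ a / suc d) ℚ.* (+ b / 1))        ≈⟨ toℚᵘ-homo-* (+ a / suc d) (+ b / 1) ⟩
    toℚᵘ (+ a / suc d) ℚᵘ.* toℚᵘ (+ b / 1)    ≈⟨ ℚᵘₚ.*-cong (toℚᵘ-/ a d) (toℚᵘ-/ b 0) ⟩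
    mkℚᵘ (+ a) d ℚᵘ.* mkℚᵘ (+ b) 0            ≈⟨ *≡* cross ⟩
    mkℚᵘ (+ (a * b)) d                         ≈⟨ ≃-sym (toℚᵘ-/ (a * b) d) ⟩
    toℚᵘ (+ (a * b) / suc d)                   ∎)
    where
    open ℚᵘₚ.≃-Reasoning
    cross : (+ a ℤ.* + b) ℤ.* + suc d ≡ + (a * b) ℤ.* + suc (d * 1)
    cross = cong₂ ℤ._*_ (sym (pos-* a b)) (cong (+_ ∘ suc) (sym (*-identityʳ d)))

  /-≤-/ : ∀ a b d e → a * suc e ≤ b * suc d → + a / suc d ℚ.≤ + b / suc e
  /-≤-/ a b d e h = toℚᵘ-cancel-≤ (≤-respˡ-≃ (≃-sym (toℚᵘ-/ a d)) (≤-respʳ-≃ (≃-sym (toℚᵘ-/ b e))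
    (*≤* (subst₂ ℤ._≤_ (pos-* a (suc e)) (pos-* b (suc d)) (+≤+ h)))))

  module _ {A : Set} where

    Defines : {r m n : ℕ} → SLP A r → Fin r → Mat A m n → Set
    Defines {m = m} {n} G i X = lookup (evalEnv G) i ≡ just (m , n , X)

    generates⇒defines-start : {r m n : ℕ} (G : SLP A (suc r)) {X : Mat A m n} →
      Generates G X → Defines G zero X
    generates⇒defines-start (G ▷ x) gen = gen

    data _⊑_ {r₀ : ℕ} (G₀ : SLP A r₀) : {r : ℕ} → SLP A r → Set where
      refl⊑ : G₀ ⊑ G₀
      ▷⊑    : {r : ℕ} {G : SLP A r} {x : Rule A r} → G₀ ⊑ G → G₀ ⊑ (G ▷ x)

    ⊑-trans : {r₀ r₁ r₂ : ℕ} {G₀ : SLP A r₀} {G₁ : SLP A r₁} {G₂ : SLP A r₂} →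
      G₀ ⊑ G₁ → G₁ ⊑ G₂ → G₀ ⊑ G₂
    ⊑-trans e refl⊑    = e
    ⊑-trans e (▷⊑ e′) = ▷⊑ (⊑-trans e e′)

    lift : {r₀ r : ℕ} {G₀ : SLP A r₀} {G : SLP A r} → G₀ ⊑ G → Fin r₀ → Fin r
    lift refl⊑  i = i
    lift (▷⊑ e) i = suc (lift e i)

    defines-lift : {r₀ r m n : ℕ} {G₀ : SLP A r₀} {G : SLP A r} (e : G₀ ⊑ G) {i : Fin r₀}
      {X : Mat A m n} → Defines G₀ i X → Defines G (lift e i) X
    defines-lift refl⊑  d = d
    defines-lift (▷⊑ e) d = defines-lift e d

    hcatM-just : {m n n′ : ℕ} (X : Mat A m n) (Y : Mat A m n′) →
      hcatM (m , n , X) (m , n′ , Y) ≡ just (m , n + n′ , zipWith _++_ X Y)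
    hcatM-just {m} X Y with m ≟ m
    ... | yes refl = refl
    ... | no m≢m   = contradiction refl m≢m

    vcatM-just : {m m′ n : ℕ} (X : Mat A m n) (Y : Mat A m′ n) →
      vcatM (m , n , X) (m′ , n , Y) ≡ just (m + m′ , n , X ++ Y)
    vcatM-just {n = n} X Y with n ≟ n
    ... | yes refl = refl
    ... | no n≢n   = contradiction refl n≢n

    -- Grammars are grown by appending rules, so the nonterminals of the prefix G₀ remain
    -- available (through lift) and can be shared by everything built afterwards.
    record Extension {r₀ : ℕ} (G₀ : SLP A r₀) {m n : ℕ} (X : Mat A m n) (s : ℕ) : Set where
      constructor extension
      field
        {rules}   : ℕ
        grammar   : SLP A (suc rules)
        prefix    : G₀ ⊑ grammar
        generates : Generates grammar X
        size≡     : size grammar ≡ size G₀ + s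

    open Extension

    terminal : {r : ℕ} (G₀ : SLP A r) (a : A) → Extension G₀ ((a ∷ []) ∷ []) 1
    terminal G₀ a = extension (G₀ ▷ term a) (▷⊑ refl⊑) refl refl

    Extension-trans : {r₀ m n m′ n′ s₁ s₂ : ℕ} {G₀ : SLP A r₀} {X : Mat A m n} {Y : Mat A m′ n′}
      (e : Extension G₀ X s₁) → Extension (grammar e) Y s₂ → Extension G₀ Y (s₁ + s₂)
    Extension-trans {s₁ = s₁} {s₂} {G₀} e e′ =
      extension (grammar e′) (⊑-trans (prefix e) (prefix e′)) (generates e′)
        (trans (size≡ e′) (trans (cong (_+ s₂) (size≡ e)) (+-assoc (size G₀) s₁ s₂)))

    hcatStep : {r₀ m n n′ s : ℕ} {G₀ : SLP A r₀} {X : Mat A m n} {Y : Mat A m n′}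
      (e : Extension G₀ Y s) (i : Fin (suc (rules e))) → Defines (grammar e) i X →
      Extension G₀ (zipWith _++_ X Y) (s + 2)
    hcatStep {s = s} {G₀} {X} {Y} e i dX =
      extension (grammar e ▷ hcat i zero) (▷⊑ (prefix e)) gen
        (trans (cong (_+ 2) (size≡ e)) (+-assoc (size G₀) s 2))
      where
      gen : Generates (grammar e ▷ hcat i zero) (zipWith _++_ X Y)
      gen rewrite dX | generates⇒defines-start (grammar e) (generates e) = hcatM-just X Y

    vcatStep : {r₀ m m′ n s : ℕ} {G₀ : SLP A r₀} {X : Mat A m n} {Y : Mat A m′ n}
      (e : Extension G₀ Y s) (i : Fin (suc (rules e))) → Defines (grammar e) i X →
      Extension G₀ (X ++ Y) (s + 2)
    vcatStep {s = s} {G₀} {X} {Y} e i dX =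
      extension (grammar e ▷ vcat i zero) (▷⊑ (prefix e)) gen
        (trans (cong (_+ 2) (size≡ e)) (+-assoc (size G₀) s 2))
      where
      gen : Generates (grammar e ▷ vcat i zero) (X ++ Y)
      gen rewrite dX | generates⇒defines-start (grammar e) (generates e) = vcatM-just X Y

    definesStart : {r₀ m n s : ℕ} {G₀ : SLP A r₀} {X : Mat A m n} (e : Extension G₀ X s) →
      Defines (grammar e) zero X
    definesStart e = generates⇒defines-start (grammar e) (generates e)

    smallest≤extension : {m n s g : ℕ} {X : Mat A m n} →
      Extension [] X s → IsSmallestSLPSize X g → g ≤ s
    smallest≤extension e (_ , minimal) =
      ≤-trans (minimal _ (grammar e) (generates e)) (≤-reflexive (size≡ e))

  -- pow2 (suc t) unfolds to pow2 t + pow2 t, the length of the concatenation of two halves;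
  -- 2 ^ suc t does not.
  pow2 : ℕ → ℕ
  pow2 zero    = 1
  pow2 (suc t) = pow2 t + pow2 t

  ↑-elim : {m n : ℕ} (Q : Fin (m + n) → Set) →
    (∀ i → Q (i ↑ˡ n)) → (∀ j → Q (m ↑ʳ j)) → ∀ k → Q k
  ↑-elim {m} {n} Q left right k with splitAt m {n} k in eq
  ... | inj₁ i = subst Q (splitAt⁻¹-↑ˡ eq) (left i)
  ... | inj₂ j = subst Q (splitAt⁻¹-↑ʳ eq) (right j)

  columnSize : ℕ → ℕ
  columnSize zero    = 1
  columnSize (suc t) = (columnSize t + columnSize t) + 2

  constColumnSize : ℕ → ℕ
  constColumnSize zero    = 1
  constColumnSize (suc t) = constColumnSize t + 2

  interleaveSize : ℕ → ℕ → ℕ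
  interleaveSize t zero    = constColumnSize t + 2
  interleaveSize t (suc s) = (interleaveSize t s + interleaveSize t s) + 2

  module _ {A : Set} where

    open Extension

    column : (t : ℕ) → (Fin (pow2 t) → A) → Mat A (pow2 t) 1
    column zero    f = (f zero ∷ []) ∷ []
    column (suc t) f = column t (f ∘ (_↑ˡ pow2 t)) ++ column t (f ∘ (pow2 t ↑ʳ_))

    interleave : (t : ℕ) → Mat A (pow2 t) 1 → (s : ℕ) → (Fin (pow2 s) → A) →
      Mat A (pow2 t) (pow2 (suc s))
    interleave t C zero    g = zipWith _++_ C (column t (λ _ → g zero))
    interleave t C (suc s) g =
      zipWith _++_ (interleave t C s (g ∘ (_↑ˡ pow2 s))) (interleave t C s (g ∘ (pow2 s ↑ʳ_)))

    columnExtension : {r₀ : ℕ} (G₀ : SLP A r₀) (t : ℕ) (f : Fin (pow2 t) → A) →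
      Extension G₀ (column t f) (columnSize t)
    columnExtension G₀ zero    f = terminal G₀ (f zero)
    columnExtension G₀ (suc t) f =
      vcatStep (Extension-trans upper lower) (lift (prefix lower) zero)
        (defines-lift (prefix lower) (definesStart upper))
      where
      upper = columnExtension G₀ t (f ∘ (_↑ˡ pow2 t))
      lower = columnExtension (grammar upper) t (f ∘ (pow2 t ↑ʳ_))

    -- Both halves are the same nonterminal, so each doubling of the height costs one rule.
    constColumnExtension : {r₀ : ℕ} (G₀ : SLP A r₀) (t : ℕ) (b : A) →
      Extension G₀ (column t (λ _ → b)) (constColumnSize t)
    constColumnExtension G₀ zero    b = terminal G₀ b
    constColumnExtension G₀ (suc t) b = vcatStep half zero (definesStart half)
      where half = constColumnExtension G₀ t b

    interleaveExtension : {r₀ : ℕ} (G₀ : SLP A r₀) (t : ℕ) {C : Mat A (pow2 t) 1} (c : Fin r₀) →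
      Defines G₀ c C → (s : ℕ) (g : Fin (pow2 s) → A) →
      Extension G₀ (interleave t C s g) (interleaveSize t s)
    interleaveExtension G₀ t c dC zero g =
      hcatStep constant (lift (prefix constant) c) (defines-lift (prefix constant) dC)
      where constant = constColumnExtension G₀ t (g zero)
    interleaveExtension G₀ t c dC (suc s) g =
      hcatStep (Extension-trans left right) (lift (prefix right) zero)
        (defines-lift (prefix right) (definesStart left))
      where
      left  = interleaveExtension G₀ t c dC s (g ∘ (_↑ˡ pow2 s))
      right = interleaveExtension (grammar left) t (lift (prefix left) c)
                (defines-lift (prefix left) dC) s (g ∘ (pow2 s ↑ʳ_))

    interleave-columnExtension : (t s : ℕ) (f : Fin (pow2 t) → A) (g : Fin (pow2 s) → A) →
      Extension [] (interleave t (column t f) s g) (columnSize t + interleaveSize t s)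
    interleave-columnExtension t s f g =
      Extension-trans C (interleaveExtension (grammar C) t zero (definesStart C) s g)
      where C = columnExtension [] t f

    lookup-column : (t : ℕ) (f : Fin (pow2 t) → A) (r : Fin (pow2 t)) →
      lookup (lookup (column t f) r) zero ≡ f r
    lookup-column zero    f zero = refl
    lookup-column (suc t) f = ↑-elim _
      (λ i → trans (cong (λ row → lookup row zero) (lookup-++ˡ (column t _) (column t _) i))
                   (lookup-column t _ i))
      (λ j → trans (cong (λ row → lookup row zero) (lookup-++ʳ (column t _) (column t _) j))
                   (lookup-column t _ j))

    lookup-hcat-↑ˡ : {m w w′ : ℕ} (W : Mat A m w) (W′ : Mat A m w′) (r : Fin m) (c : Fin w) →
      lookup (lookup (zipWith _++_ W W′) r) (c ↑ˡ w′) ≡ lookup (lookup W r) c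
    lookup-hcat-↑ˡ W W′ r c =
      trans (cong (λ row → lookup row _) (lookup-zipWith _++_ r W W′)) (lookup-++ˡ (lookup W r) _ c)

    lookup-hcat-↑ʳ : {m w w′ : ℕ} (W : Mat A m w) (W′ : Mat A m w′) (r : Fin m) (c : Fin w′) →
      lookup (lookup (zipWith _++_ W W′) r) (w ↑ʳ c) ≡ lookup (lookup W′ r) c
    lookup-hcat-↑ʳ W W′ r c =
      trans (cong (λ row → lookup row _) (lookup-zipWith _++_ r W W′)) (lookup-++ʳ (lookup W r) _ c)

    record ColumnPair {m w : ℕ} (W : Mat A m w) (C : Mat A m 1) (b : A) : Set where
      field
        left right  : Fin w
        toℕ-right   : toℕ right ≡ suc (toℕ left)
        lookup-left  : ∀ r → lookup (lookup W r) left ≡ lookup (lookup C r) zero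
        lookup-right : ∀ r → lookup (lookup W r) right ≡ b

    open ColumnPair

    columnPair-hcatˡ : {m w w′ : ℕ} {W : Mat A m w} (W′ : Mat A m w′) {C : Mat A m 1} {b : A} →
      ColumnPair W C b → ColumnPair (zipWith _++_ W W′) C b
    columnPair-hcatˡ {w′ = w′} {W} W′ cp = record
      { left         = left cp ↑ˡ w′
      ; right        = right cp ↑ˡ w′
      ; toℕ-right    = trans (toℕ-↑ˡ (right cp) w′)
                         (trans (toℕ-right cp) (cong suc (sym (toℕ-↑ˡ (left cp) w′))))
      ; lookup-left  = λ r → trans (lookup-hcat-↑ˡ W W′ r (left cp)) (lookup-left cp r)
      ; lookup-right = λ r → trans (lookup-hcat-↑ˡ W W′ r (right cp)) (lookup-right cp r)
      }

    columnPair-hcatʳ : {m w w′ : ℕ} (W : Mat A m w) {W′ : Mat A m w′} {C : Mat A m 1} {b : A} →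
      ColumnPair W′ C b → ColumnPair (zipWith _++_ W W′) C b
    columnPair-hcatʳ {w = w} W {W′} cp = record
      { left         = w ↑ʳ left cp
      ; right        = w ↑ʳ right cp
      ; toℕ-right    = trans (toℕ-↑ʳ w (right cp))
                         (trans (cong (_+_ w) (toℕ-right cp))
                           (trans (+-suc w _) (cong suc (sym (toℕ-↑ʳ w (left cp))))))
      ; lookup-left  = λ r → trans (lookup-hcat-↑ʳ W W′ r (left cp)) (lookup-left cp r)
      ; lookup-right = λ r → trans (lookup-hcat-↑ʳ W W′ r (right cp)) (lookup-right cp r)
      }

    interleave-columnPair : (t : ℕ) (C : Mat A (pow2 t) 1) (s : ℕ) (g : Fin (pow2 s) → A)
      (p : Fin (pow2 s)) → ColumnPair (interleave t C s g) C (g p)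
    interleave-columnPair t C zero g zero = record
      { left         = zero
      ; right        = suc zero
      ; toℕ-right    = refl
      ; lookup-left  = λ r → lookup-hcat-↑ˡ C B r zero
      ; lookup-right = λ r → trans (lookup-hcat-↑ʳ C B r zero) (lookup-column t _ r)
      }
      where B = column t (λ _ → g zero)
    interleave-columnPair t C (suc s) g = ↑-elim _
      (λ i → columnPair-hcatˡ _ (interleave-columnPair t C s (g ∘ (_↑ˡ pow2 s)) i))
      (λ j → columnPair-hcatʳ _ (interleave-columnPair t C s (g ∘ (pow2 s ↑ʳ_)) j))

    pairOffset : {m w : ℕ} {W : Mat A m w} {C : Mat A m 1} {b : A} →
      ColumnPair W C b → Fin (suc (w ∸ 2))
    pairOffset {w = w} cp = fromℕ< (s≤s (m+n≤o⇒m≤o∸n (toℕ (left cp)) left+2≤w))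
      where
      left+2≤w : toℕ (left cp) + 2 ≤ w
      left+2≤w = subst (_≤ w) (+-comm 2 _) (subst (_< w) (toℕ-right cp) (toℕ<n (right cp)))

    topRow-pairWindow : {m w : ℕ} {W : Mat A m w} {C : Mat A m 1} {b : A}
      (cp : ColumnPair W C b) (q₁ : 2 ≤ m) (q₂ : 2 ≤ w) (i : Fin (suc (m ∸ 2))) →
      lookup (subMat W 2 2 q₁ q₂ i (pairOffset cp)) zero
        ≡ lookup (lookup C (winIdx m 2 q₁ i zero)) zero ∷ b ∷ []
    topRow-pairWindow {m} {w} {W} cp q₁ q₂ i =
      cong₂ (λ x y → x ∷ y ∷ [])
        (trans (cong (lookup row) at-left) (lookup-left cp _))
        (trans (cong (lookup row) at-right) (lookup-right cp _))
      where
      row = lookup W (winIdx m 2 q₁ i zero)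
      offset = toℕ (pairOffset cp)
      at-left : winIdx w 2 q₂ (pairOffset cp) zero ≡ left cp
      at-left = toℕ-injective (trans (toℕ-winIdx w 2 q₂ _ zero)
                  (trans (+-identityʳ offset) (toℕ-fromℕ< _)))
      at-right : winIdx w 2 q₂ (pairOffset cp) (suc zero) ≡ right cp
      at-right = toℕ-injective (trans (toℕ-winIdx w 2 q₂ _ (suc zero))
                   (trans (+-comm offset 1) (trans (cong suc (toℕ-fromℕ< _)) (sym (toℕ-right cp)))))

  module _ where
    open +-*-Solver

    [x+x+2]+2≡ : ∀ x → ((x + x) + 2) + 2 ≡ (x + 2) + (x + 2)
    [x+x+2]+2≡ = solve 1 (λ x → ((x :+ x) :+ con 2) :+ con 2 := (x :+ con 2) :+ (x :+ con 2)) refl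

    columnSize+2≡ : ∀ t → columnSize t + 2 ≡ 3 * pow2 t
    columnSize+2≡ zero    = refl
    columnSize+2≡ (suc t) = begin
      ((c + c) + 2) + 2   ≡⟨ [x+x+2]+2≡ c ⟩
      (c + 2) + (c + 2)   ≡⟨ cong₂ _+_ (columnSize+2≡ t) (columnSize+2≡ t) ⟩
      3 * p + 3 * p       ≡⟨ sym (*-distribˡ-+ 3 p p) ⟩
      3 * (p + p)         ∎
      where
      open ≡-Reasoning
      c = columnSize t
      p = pow2 t

    constColumnSize≡ : ∀ t → constColumnSize t ≡ 1 + 2 * t
    constColumnSize≡ zero    = refl
    constColumnSize≡ (suc t) = trans (cong (_+ 2) (constColumnSize≡ t))
      (solve 1 (λ t → (con 1 :+ con 2 :* t) :+ con 2 := con 1 :+ con 2 :* (con 1 :+ t)) refl t)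

    interleaveSize+2≡ : ∀ t s → interleaveSize t s + 2 ≡ pow2 s * (constColumnSize t + 4)
    interleaveSize+2≡ t zero    =
      trans (+-assoc (constColumnSize t) 2 2) (sym (*-identityˡ (constColumnSize t + 4)))
    interleaveSize+2≡ t (suc s) = begin
      ((w + w) + 2) + 2   ≡⟨ [x+x+2]+2≡ w ⟩
      (w + 2) + (w + 2)   ≡⟨ cong₂ _+_ (interleaveSize+2≡ t s) (interleaveSize+2≡ t s) ⟩
      p * b + p * b       ≡⟨ sym (*-distribʳ-+ b p p) ⟩
      (p + p) * b         ∎
      where
      open ≡-Reasoning
      w = interleaveSize t s
      p = pow2 s
      b = constColumnSize t + 4

    grammarSize≤ : ∀ s → columnSize (suc s) + interleaveSize (suc s) s ≤ pow2 s * (2 * s + 13)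
    grammarSize≤ s = begin
      columnSize (suc s) + interleaveSize (suc s) s
        ≤⟨ +-mono-≤ (m≤m+n (columnSize (suc s)) 2) (m≤m+n (interleaveSize (suc s) s) 2) ⟩
      (columnSize (suc s) + 2) + (interleaveSize (suc s) s + 2)
        ≡⟨ cong₂ _+_ (columnSize+2≡ (suc s)) (interleaveSize+2≡ (suc s) s) ⟩
      3 * (p + p) + p * (constColumnSize (suc s) + 4)
        ≡⟨ cong (λ b → 3 * (p + p) + p * (b + 4)) (constColumnSize≡ (suc s)) ⟩
      3 * (p + p) + p * ((1 + 2 * suc s) + 4)
        ≡⟨ solve 2 (λ p s → con 3 :* (p :+ p) :+ p :* ((con 1 :+ con 2 :* (con 1 :+ s)) :+ con 4)
                            := p :* (con 2 :* s :+ con 13)) refl p s ⟩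
      p * (2 * s + 13) ∎
      where
      open ≤-Reasoning
      p = pow2 s

  pow2≡2^ : ∀ t → pow2 t ≡ 2 ^ t
  pow2≡2^ zero    = refl
  pow2≡2^ (suc t) = cong₂ _+_ (pow2≡2^ t) (trans (pow2≡2^ t) (sym (+-identityʳ (2 ^ t))))

  ⌊log₂[pow2²]⌋≡ : ∀ t → ⌊log₂ (pow2 t * pow2 t) ⌋ ≡ t + t
  ⌊log₂[pow2²]⌋≡ t = trans
    (cong ⌊log₂_⌋ (trans (cong₂ _*_ (pow2≡2^ t) (pow2≡2^ t)) (sym (^-distribˡ-+-* 2 t t))))
    (⌊log₂[2^n]⌋≡n (t + t))

  1≤pow2 : ∀ t → 1 ≤ pow2 t
  1≤pow2 zero    = s≤s z≤n
  1≤pow2 (suc t) = ≤-trans (1≤pow2 t) (m≤m+n _ _)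

  m≤1+[m+m∸2] : ∀ {m} → 1 ≤ m → m ≤ suc (m + m ∸ 2)
  m≤1+[m+m∸2] {suc m} _ rewrite +-suc m m = s≤s (m≤m+n m m)

  t≤pow2 : ∀ t → t ≤ pow2 t
  t≤pow2 zero    = z≤n
  t≤pow2 (suc t) = +-mono-≤ (1≤pow2 t) (t≤pow2 t)

  module Family (s : ℕ) where

    half n : ℕ
    half = pow2 s
    n    = pow2 (suc s)

    M : Mat (Fin n) n n
    M = interleave (suc s) (column (suc s) id) s (_↑ˡ half)

    s≤n : s ≤ n
    s≤n = ≤-trans (t≤pow2 s) (m≤m+n _ _)

    2≤n : 2 ≤ n
    2≤n = +-mono-≤ (1≤pow2 s) (1≤pow2 s)

    pair : (p : Fin half) → ColumnPair M (column (suc s) id) (p ↑ˡ half)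
    pair = interleave-columnPair (suc s) (column (suc s) id) s (_↑ˡ half)

    offsets : Fin (suc (n ∸ 2)) × Fin half → Fin (suc (n ∸ 2)) × Fin (suc (n ∸ 2))
    offsets (i , p) = i , pairOffset (pair p)

    window : Fin (suc (n ∸ 2)) × Fin half → Mat (Fin n) 2 2
    window = uncurry (subMat M 2 2 2≤n 2≤n) ∘ offsets

    topRow-window : ∀ i p → lookup (window (i , p)) zero ≡ winIdx n 2 2≤n i zero ∷ (p ↑ˡ half) ∷ []
    topRow-window i p =
      trans (topRow-pairWindow (pair p) 2≤n 2≤n i)
            (cong (λ x → x ∷ (p ↑ˡ half) ∷ []) (lookup-column (suc s) id _))

    window-injective : Injective _≡_ _≡_ window
    window-injective {i , p} {i′ , p′} eq =
      cong₂ _,_ (winIdx-injectiveˡ n 2 2≤n zero same-row) (↑ˡ-injective half p p′ same-letter)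
      where
      topRows = trans (sym (topRow-window i p))
                  (trans (cong (λ X → lookup X zero) eq) (topRow-window i′ p′))
      same-row    = proj₁ (∷-injective topRows)
      same-letter = proj₁ (∷-injective (proj₂ (∷-injective topRows)))

    distinct-2×2-windows : suc (n ∸ 2) * half ≤ P M 2 2
    distinct-2×2-windows = ≤-P-of-injective-windows M 2 2 2≤n 2≤n (offsets ∘ remQuot half)
      (Injection.injective (↔⇒↣ *↔×) ∘ window-injective)

    M-extension : Extension [] M (columnSize (suc s) + interleaveSize (suc s) s)
    M-extension = interleave-columnExtension (suc s) s id (_↑ˡ half)

    L₁ L₂ : ℕ
    L₁ = ⌊log₂ (n * n) ⌋
    L₂ = ⌊log₂ L₁ ⌋

    half≤rows : half ≤ suc (n ∸ 2)
    half≤rows = m≤1+[m+m∸2] (1≤pow2 s)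

    1≤L₂ : 1 ≤ L₂
    1≤L₂ = ⌊log₂⌋-mono-≤ {2} {L₁}
      (subst (2 ≤_) (sym (⌊log₂[pow2²]⌋≡ (suc s))) (s≤s (≤-trans (s≤s z≤n) (m≤n+m (suc s) s))))

    -- The bound of δ□-bound below, with its denominators 64 and 4 cleared.
    grammar-vs-windows : ∀ {g} → g ≤ half * (2 * s + 13) →
      1 * g * n * 4 ≤ suc (n ∸ 2) * half * L₁ * L₂ * 64
    grammar-vs-windows {g} g≤ = begin
      1 * g * n * 4
        ≤⟨ *-monoˡ-≤ 4 (*-monoˡ-≤ n (*-monoʳ-≤ 1 g≤)) ⟩
      1 * (h * (2 * s + 13)) * (h + h) * 4
        ≡⟨ solve 2 (λ h s → con 1 :* (h :* (con 2 :* s :+ con 13)) :* (h :+ h) :* con 4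
                            := h :* h :* (con 16 :* s :+ con 104)) refl h s ⟩
      h * h * (16 * s + 104)
        ≤⟨ *-monoʳ-≤ (h * h) (+-mono-≤ (*-monoˡ-≤ s (m≤m+n 16 112)) (m≤m+n 104 24)) ⟩
      h * h * (128 * s + 128)
        ≡⟨ solve 2 (λ h s → h :* h :* (con 128 :* s :+ con 128)
                            := h :* h :* (con 1 :+ s :+ (con 1 :+ s)) :* con 1 :* con 64) refl h s ⟩
      h * h * (suc s + suc s) * 1 * 64
        ≤⟨ *-monoˡ-≤ 64 (*-mono-≤ (*-mono-≤ (*-monoˡ-≤ h half≤rows)
                                      (≤-reflexive (sym (⌊log₂[pow2²]⌋≡ (suc s))))) 1≤L₂) ⟩
      suc (n ∸ 2) * h * L₁ * L₂ * 64 ∎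
      where
      open ≤-Reasoning
      open +-*-Solver
      h = half

    K/4≤δ□ : + (suc (n ∸ 2) * half) / 4 ℚ.≤ δ□ M
    K/4≤δ□ = ℚₚ.≤-trans
      (/-≤-/ (suc (n ∸ 2) * half) (P M 2 2) 3 3 (*-monoˡ-≤ 4 distinct-2×2-windows))
      (P/k²≤δ-upTo M {1} 2≤n)

    δ□-bound : (g : ℕ) → IsSmallestSLPSize M g →
      (+ 1 / 64) ℚ.* (+ g / 1) ℚ.* (+ n / 1) ℚ.≤ δ□ M ℚ.* (+ L₁ / 1) ℚ.* (+ L₂ / 1)
    δ□-bound g smallest = begin
      (+ 1 / 64) ℚ.* (+ g / 1) ℚ.* (+ n / 1)
        ≡⟨ trans (cong (ℚ._* (+ n / 1)) (/-*-/1 1 g 63)) (/-*-/1 (1 * g) n 63) ⟩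
      + (1 * g * n) / 64
        ≤⟨ /-≤-/ (1 * g * n) (K * L₁ * L₂) 63 3 (grammar-vs-windows g≤) ⟩
      + (K * L₁ * L₂) / 4
        ≡⟨ sym (trans (cong (ℚ._* (+ L₂ / 1)) (/-*-/1 K L₁ 3)) (/-*-/1 (K * L₁) L₂ 3)) ⟩
      (+ K / 4) ℚ.* (+ L₁ / 1) ℚ.* (+ L₂ / 1)
        ≤⟨ *-monoʳ-≤-nonNeg (+ L₂ / 1) {{normalize-nonNeg L₂ 1}}
             (*-monoʳ-≤-nonNeg (+ L₁ / 1) {{normalize-nonNeg L₁ 1}} K/4≤δ□) ⟩
      δ□ M ℚ.* (+ L₁ / 1) ℚ.* (+ L₂ / 1) ∎
      where
      open ℚₚ.≤-Reasoning
      K = suc (n ∸ 2) * half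
      g≤ = ≤-trans (smallest≤extension M-extension smallest) (grammarSize≤ s)

open import Data.Nat using (ℕ; _≤_)
open import Data.Nat.Logarithm using (⌊log₂_⌋)
open import Data.Fin using (Fin)
open import Data.Product using (Σ; _×_; ∃-syntax)
open import Data.Integer using (+_)
open import Data.Rational using (ℚ; 0ℚ; _<_; _*_)
import Data.Rational as Q
import Data.Nat as N
open import Data.Product using (_,_)
open import Data.Rational.Properties using (positive⁻¹)

proposition12 :
    Σ ℚ λ c → (0ℚ < c) ×
      ((n₀ : ℕ) → Σ ℕ λ n → (n₀ ≤ n) × Σ ℕ λ σ → Σ (Mat (Fin σ) n n) λ M →
        (g : ℕ) → IsSmallestSLPSize M g →
          c * ((+ g) Q./ 1) * ((+ n) Q./ 1)
            Q.≤ δ□ M * ((+ ⌊log₂ (n N.* n) ⌋) Q./ 1) * ((+ ⌊log₂ ⌊log₂ (n N.* n) ⌋ ⌋) Q./ 1))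
proposition12 = ((+ 1) Q./ 64) , positive⁻¹ _ , λ s →
  n s , s≤n s , n s , M s , δ□-bound s
  where open Family
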